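{- Let $t,n\ge 1$, let $x\in\{0,1\}^{tn}$ and let $y\in\{0,1\}^{tn}$. Then there exists $i$ with $0\le i<n$ such that $\mathsf{Rot}^{it}(y)$ is lexicographically smaller than $x$ if and only if at least one of the following holds: 1. some $w\in L_x$ appears as a contiguous substring of $y$ starting at a coordinate $j$ with $j\equiv 0\pmod t$, where the coordinates are numbered $0,1,\dots,tn-1$; 2. there exist strings $w_1,w_2$ such that $w_1w_2\in L_x$, $w_2$ is a prefix of $y$, $w_1$ is a suffix of $y$, and $|w_1|\equiv 0\pmod t$.
   Context: For a binary string $y$, $\mathsf{Rot}^k(y)$ denotes $y$ cyclically rotated rightwards by $k$ positions. For $x\in\{0,1\}^m$, the set of witnesses is $L_x=\{s0 : s1\text{ is a prefix of }x\}$, and $uv$ denotes concatenation. -}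

module Defs where

open import Data.Bool using (Bool; true; false)
import Data.Bool as B
open import Data.Nat using (ℕ; _∸_)
open import Data.List using (List; []; _∷_; _++_; length; take; drop; [_])
open import Data.Product using (Σ; _×_)
open import Data.List.Relation.Binary.Lex.Strict using (Lex-<)
open import Function using (_∘_)
open import Relation.Binary.PropositionalEquality using (_≡_)

BitString : Set
BitString = List Bool

-- rotate rightwards by one position: last bit moved to the front
rot1 : BitString → BitString
rot1 xs = drop (length xs ∸ 1) xs ++ take (length xs ∸ 1) xs

Rot : ℕ → BitString → BitString
Rot ℕ.zero    y = y
Rot (ℕ.suc k) y = rot1 (Rot k y)

_<lex_ : BitString → BitString → Set
_<lex_ = Lex-< _≡_ B._<_

IsPrefix : BitString → BitString → Set
IsPrefix w y = Σ BitString (λ r → w ++ r ≡ y)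

IsSuffix : BitString → BitString → Set
IsSuffix w y = Σ BitString (λ u → u ++ w ≡ y)

-- w ∈ L_x  iff  w = s0 with s1 a prefix of x
InL : BitString → BitString → Set
InL x w = Σ BitString (λ s → (w ≡ s ++ [ false ]) × IsPrefix (s ++ [ true ]) x)

-- Rotating y = p ++ q rightwards by |q| gives q ++ p, so the rotations of y by it with i < n
-- are exactly the strings q ++ p with y = p ++ q and t ∣ |q|. A string of the same length as x
-- is lexicographically below x iff it has a prefix s0 in L_x (it agrees with x up to a
-- position where x has 1 and it has 0). A prefix w of q ++ p either lies inside q, giving an
-- occurrence of w in y at the aligned position |p|, or it wraps around, w = q ++ w₂ with w₂ a
-- prefix of p, so that w₁ = q is an aligned suffix of y.
module Submission where

open import Defs
open import Data.Bool using (Bool; true; false)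
import Data.Bool as B
open import Data.Nat using (ℕ; _*_; _≤_; _<_; zero; suc; _+_; _∸_; s≤s)
open import Data.Nat.Properties
  using (suc-injective; ≤-total; ≤-trans; ≤-reflexive; <⇒≤; m≤n+m; +-comm;
         +-cancelˡ-≤; *-comm; *-monoˡ-≤; *-cancelʳ-<; m∸[m∸n]≡n; module ≤-Reasoning)
open import Data.Nat.Divisibility using (_∣_; divides; ∣m+n∣m⇒∣n; n∣m*n; m∣m*n)
open import Data.List using (List; _++_; length; []; _∷_; [_]; take; drop; _∷ʳ_)
open import Data.List.Properties
  using (∷-injective; length-++; length-++-comm; length-++-≤ˡ; length-++-sucʳ; length-drop;
         ++-assoc; ∷ʳ-++; ++-identityʳ; ++-cancelˡ; take++drop≡id)
open import Data.List.Relation.Binary.Lex.Core using (base; halt; this; next)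
open import Data.Product using (Σ; _×_; _,_; map₂)
open import Data.Sum using (_⊎_; inj₁; inj₂)
open import Function using (_∘_)
open import Function.Bundles using (_⇔_; mk⇔; Equivalence)
open import Function.Properties.Equivalence using (⇔-setoid)
open import Level using (0ℓ)
import Relation.Binary.Reasoning.Setoid as SetoidReasoning
open import Relation.Binary.PropositionalEquality hiding ([_])

take-length-++ : {A : Set} (xs ys : List A) → take (length xs) (xs ++ ys) ≡ xs
take-length-++ []       ys = refl
take-length-++ (x ∷ xs) ys = cong (x ∷_) (take-length-++ xs ys)

drop-length-++ : {A : Set} (xs ys : List A) → drop (length xs) (xs ++ ys) ≡ ys
drop-length-++ []       ys = refl
drop-length-++ (x ∷ xs) ys = drop-length-++ xs ys

rot1-∷ʳ : (xs : BitString) (c : Bool) → rot1 (xs ∷ʳ c) ≡ c ∷ xs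
rot1-∷ʳ xs c rewrite length-++ xs {[ c ]} | +-comm (length xs) 1 =
  cong₂ _++_ (drop-length-++ xs [ c ]) (take-length-++ xs [ c ])

Rot-++ : (k : ℕ) (p q : BitString) → length q ≡ k → Rot k (p ++ q) ≡ q ++ p
Rot-++ zero    p []      refl = ++-identityʳ p
Rot-++ (suc k) p (c ∷ q) len  = begin
  rot1 (Rot k (p ++ c ∷ q))         ≡⟨ cong (rot1 ∘ Rot k) (sym (∷ʳ-++ p c q)) ⟩
  rot1 (Rot k (p ∷ʳ c ++ q))        ≡⟨ cong rot1 (Rot-++ k (p ∷ʳ c) q (suc-injective len)) ⟩
  rot1 (q ++ p ++ [ c ])            ≡⟨ cong rot1 (sym (++-assoc q p [ c ])) ⟩
  rot1 ((q ++ p) ∷ʳ c)              ≡⟨ rot1-∷ʳ (q ++ p) c ⟩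
  c ∷ q ++ p                        ∎
  where open ≡-Reasoning

prefix-of-longer : (w u : BitString) {r s : BitString} →
  w ++ r ≡ u ++ s → length w ≤ length u → IsPrefix w u
prefix-of-longer []      u       _  _         = u , refl
prefix-of-longer (a ∷ w) (b ∷ u) eq (s≤s len) with ∷-injective eq
... | refl , eq′ = map₂ (cong (a ∷_)) (prefix-of-longer w u eq′ len)

HasLPrefix : BitString → BitString → Set
HasLPrefix x z = Σ BitString λ w → InL x w × IsPrefix w z

InL-length : (x w : BitString) → InL x w → length w ≤ length x
InL-length x w (s , refl , (r , refl)) = ≤-trans
  (≤-reflexive (trans (length-++-sucʳ s false []) (sym (length-++-sucʳ s true []))))
  (length-++-≤ˡ (s ++ [ true ]))

<lex⇒HasLPrefix : (z x : BitString) → length z ≡ length x → z <lex x → HasLPrefix x z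
<lex⇒HasLPrefix []          []         _   (base ())
<lex⇒HasLPrefix []          (_ ∷ _)    ()  halt
<lex⇒HasLPrefix (false ∷ z) (true ∷ x) _   (this B.f<t) = [ false ] , ([] , refl , (x , refl)) , (z , refl)
<lex⇒HasLPrefix (a ∷ z)     (.a ∷ x)   len (next refl z<x)
  with <lex⇒HasLPrefix z x (suc-injective len) z<x
... | w , (s , refl , (r , x≡)) , (r′ , z≡) =
  a ∷ w , (a ∷ s , refl , (r , cong (a ∷_) x≡)) , (r′ , cong (a ∷_) z≡)

++-false-<lex-++-true : (s r r′ : BitString) → (s ++ false ∷ r) <lex (s ++ true ∷ r′)
++-false-<lex-++-true []      r r′ = this B.f<t
++-false-<lex-++-true (a ∷ s) r r′ = next refl (++-false-<lex-++-true s r r′)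

HasLPrefix⇒<lex : (z x : BitString) → HasLPrefix x z → z <lex x
HasLPrefix⇒<lex z x (_ , (s , refl , (r′ , refl)) , (r , refl))
  rewrite ++-assoc s [ false ] r | ++-assoc s [ true ] r′ = ++-false-<lex-++-true s r r′

<lex⇔HasLPrefix : (z x : BitString) → length z ≡ length x → z <lex x ⇔ HasLPrefix x z
<lex⇔HasLPrefix z x len = mk⇔ (<lex⇒HasLPrefix z x len) (HasLPrefix⇒<lex z x)

AlignedRotation : ℕ → BitString → (BitString → Set) → Set
AlignedRotation t y P = Σ BitString λ p → Σ BitString λ q →
  (y ≡ p ++ q) × (t ∣ length q) × P (q ++ p)

AlignedRotation-map : {P Q : BitString → Set} (t : ℕ) (y : BitString) →
  (∀ z → length z ≡ length y → P z → Q z) →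
  AlignedRotation t y P → AlignedRotation t y Q
AlignedRotation-map t y f (p , q , refl , t∣q , Pqp) =
  p , q , refl , t∣q , f (q ++ p) (length-++-comm q p) Pqp

AlignedRotation-cong : {P Q : BitString → Set} (t : ℕ) (y : BitString) →
  (∀ z → length z ≡ length y → P z ⇔ Q z) →
  AlignedRotation t y P ⇔ AlignedRotation t y Q
AlignedRotation-cong t y P⇔Q = mk⇔
  (AlignedRotation-map t y (λ z len → Equivalence.to (P⇔Q z len)))
  (AlignedRotation-map t y (λ z len → Equivalence.from (P⇔Q z len)))

Rot-multiple⇒AlignedRotation : (P : BitString → Set) (t n : ℕ) (y : BitString) →
  length y ≡ t * n → Σ ℕ (λ i → (i < n) × P (Rot (i * t) y)) → AlignedRotation t y P
Rot-multiple⇒AlignedRotation P t n y len (i , i<n , P-rot) =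
  p , q , y≡p++q , subst (t ∣_) (sym |q|≡it) (n∣m*n i) ,
  subst P (trans (cong (Rot (i * t)) y≡p++q) (Rot-++ (i * t) p q |q|≡it)) P-rot
  where
  m = t * n ∸ i * t
  p = take m y
  q = drop m y
  y≡p++q : y ≡ p ++ q
  y≡p++q = sym (take++drop≡id m y)
  it≤tn : i * t ≤ t * n
  it≤tn = subst (i * t ≤_) (*-comm n t) (*-monoˡ-≤ t (<⇒≤ i<n))
  |q|≡it : length q ≡ i * t
  |q|≡it = trans (length-drop m y) (trans (cong (_∸ m) len) (m∸[m∸n]≡n it≤tn))

-- The split with p = [] is the rotation by 0, not by n * t.
AlignedRotation⇒Rot-multiple : (P : BitString → Set) (t n : ℕ) (y : BitString) →
  1 ≤ n → length y ≡ t * n → AlignedRotation t y P → Σ ℕ (λ i → (i < n) × P (Rot (i * t) y))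
AlignedRotation⇒Rot-multiple P t n .([] ++ q) n≥1 _ ([] , q , refl , _ , Pq) =
  0 , n≥1 , subst P (++-identityʳ q) Pq
AlignedRotation⇒Rot-multiple P t n .(c ∷ p ++ q) n≥1 len (c ∷ p , q , refl , divides k |q|≡kt , Pqp) =
  k , *-cancelʳ-< t k n kt<nt , subst P (sym (Rot-++ (k * t) (c ∷ p) q |q|≡kt)) Pqp
  where
  open ≤-Reasoning
  kt<nt : k * t < n * t
  kt<nt = begin-strict
    k * t                     ≡⟨ sym |q|≡kt ⟩
    length q                  <⟨ s≤s (m≤n+m (length q) (length p)) ⟩
    suc (length p + length q) ≡⟨ cong suc (sym (length-++ p)) ⟩
    length (c ∷ p ++ q)       ≡⟨ len ⟩
    t * n                     ≡⟨ *-comm t n ⟩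
    n * t                     ∎

Rot-multiple⇔AlignedRotation : (P : BitString → Set) (t n : ℕ) (y : BitString) →
  1 ≤ n → length y ≡ t * n → Σ ℕ (λ i → (i < n) × P (Rot (i * t) y)) ⇔ AlignedRotation t y P
Rot-multiple⇔AlignedRotation P t n y n≥1 len =
  mk⇔ (Rot-multiple⇒AlignedRotation P t n y len) (AlignedRotation⇒Rot-multiple P t n y n≥1 len)

AlignedOccurrence : ℕ → BitString → BitString → Set
AlignedOccurrence t x y = Σ BitString λ w → InL x w × Σ BitString λ u → Σ BitString λ v →
  (y ≡ u ++ w ++ v) × (t ∣ length u)

WrappedOccurrence : ℕ → BitString → BitString → Set
WrappedOccurrence t x y = Σ BitString λ w₁ → Σ BitString λ w₂ →
  InL x (w₁ ++ w₂) × IsPrefix w₂ y × IsSuffix w₁ y × (t ∣ length w₁)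

AlignedRotation⇒Occurrence : (t : ℕ) (x y : BitString) → t ∣ length y →
  AlignedRotation t y (HasLPrefix x) → AlignedOccurrence t x y ⊎ WrappedOccurrence t x y
AlignedRotation⇒Occurrence t x .(p ++ q) t∣y (p , q , refl , t∣q , w , w∈L , r , w++r≡q++p)
  with ≤-total (length w) (length q)
... | inj₁ |w|≤|q| with prefix-of-longer w q w++r≡q++p |w|≤|q|
...   | m , refl = inj₁ (w , w∈L , p , m , refl , t∣p)
  where
  t∣p : t ∣ length p
  t∣p = ∣m+n∣m⇒∣n (subst (t ∣_) (trans (length-++-comm p q) (length-++ q)) t∣y) t∣q
AlignedRotation⇒Occurrence t x .(p ++ q) t∣y (p , q , refl , t∣q , w , w∈L , r , w++r≡q++p)
    | inj₂ |q|≤|w| with prefix-of-longer q w (sym w++r≡q++p) |q|≤|w|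
...   | m , refl = inj₂ (q , m , w∈L , (r ++ q , y≡) , (p , refl) , t∣q)
  where
  m++r≡p : m ++ r ≡ p
  m++r≡p = ++-cancelˡ q (m ++ r) p (trans (sym (++-assoc q m r)) w++r≡q++p)
  y≡ : m ++ r ++ q ≡ p ++ q
  y≡ = trans (sym (++-assoc m r q)) (cong (_++ q) m++r≡p)

Occurrence⇒AlignedRotation : (t : ℕ) (x y : BitString) → t ∣ length y → length x ≤ length y →
  AlignedOccurrence t x y ⊎ WrappedOccurrence t x y → AlignedRotation t y (HasLPrefix x)
Occurrence⇒AlignedRotation t x .(u ++ w ++ v) t∣y _ (inj₁ (w , w∈L , u , v , refl , t∣u)) =
  u , w ++ v , refl , ∣m+n∣m⇒∣n (subst (t ∣_) (length-++ u) t∣y) t∣u ,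
  w , w∈L , v ++ u , sym (++-assoc w v u)
Occurrence⇒AlignedRotation t x y t∣y |x|≤|y| (inj₂ (w₁ , w₂ , w∈L , (r , w₂++r≡y) , (u , refl) , t∣w₁))
  with prefix-of-longer w₂ u w₂++r≡y |w₂|≤|u|
  where
  open ≤-Reasoning
  |w₂|≤|u| : length w₂ ≤ length u
  |w₂|≤|u| = +-cancelˡ-≤ (length w₁) (length w₂) (length u) (begin
    length w₁ + length w₂ ≡⟨ sym (length-++ w₁) ⟩
    length (w₁ ++ w₂)     ≤⟨ ≤-trans (InL-length x (w₁ ++ w₂) w∈L) |x|≤|y| ⟩
    length (u ++ w₁)      ≡⟨ length-++-comm u w₁ ⟩
    length (w₁ ++ u)      ≡⟨ length-++ w₁ ⟩
    length w₁ + length u  ∎)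
... | m , refl = u , w₁ , refl , t∣w₁ , w₁ ++ w₂ , w∈L , m , ++-assoc w₁ w₂ m

AlignedRotation⇔Occurrence : (t : ℕ) (x y : BitString) → t ∣ length y → length x ≤ length y →
  AlignedRotation t y (HasLPrefix x) ⇔ (AlignedOccurrence t x y ⊎ WrappedOccurrence t x y)
AlignedRotation⇔Occurrence t x y t∣y |x|≤|y| =
  mk⇔ (AlignedRotation⇒Occurrence t x y t∣y) (Occurrence⇒AlignedRotation t x y t∣y |x|≤|y|)

lemma2p12 : (t n : ℕ) → 1 ≤ t → 1 ≤ n → (x y : BitString) →
    length x ≡ t * n → length y ≡ t * n →
    (Σ ℕ (λ i → (i < n) × (Rot (i * t) y <lex x)))
    ⇔
    ((Σ BitString (λ w → InL x w × Σ BitString (λ u → Σ BitString (λ v →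
        (y ≡ u ++ w ++ v) × (t ∣ length u)))))
     ⊎
     (Σ BitString (λ w₁ → Σ BitString (λ w₂ →
        InL x (w₁ ++ w₂) × IsPrefix w₂ y × IsSuffix w₁ y × (t ∣ length w₁)))))
lemma2p12 t n _ n≥1 x y |x|≡tn |y|≡tn = begin
  Σ ℕ (λ i → (i < n) × (Rot (i * t) y <lex x))
    ≈⟨ Rot-multiple⇔AlignedRotation (_<lex x) t n y n≥1 |y|≡tn ⟩
  AlignedRotation t y (_<lex x)
    ≈⟨ AlignedRotation-cong t y (λ z |z|≡|y| → <lex⇔HasLPrefix z x (trans |z|≡|y| |y|≡|x|)) ⟩
  AlignedRotation t y (HasLPrefix x)
    ≈⟨ AlignedRotation⇔Occurrence t x y t∣y (≤-reflexive (sym |y|≡|x|)) ⟩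
  (AlignedOccurrence t x y ⊎ WrappedOccurrence t x y) ∎
  where
  open SetoidReasoning (⇔-setoid 0ℓ)
  |y|≡|x| : length y ≡ length x
  |y|≡|x| = trans |y|≡tn (sym |x|≡tn)
  t∣y : t ∣ length y
  t∣y = subst (t ∣_) (sym |y|≡tn) (m∣m*n n)
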